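{- Let $\Gamma$ be a doubly regular $(m,r)$-team semicomplete multipartite digraph with partite sets $V_1,\dots,V_m$. Let $i\neq j$, $x\in V_i$ and $y\in V_j$. Then $|E_j(x)|=|E_i(y)|$. Consequently $|E_j(x)|$ does not depend on the choice of $x\in V_i$, and denoting this value by $e_{ij}$ we have $e_{ij}=e_{ji}$.
   Context: A digraph has vertex set $V\Gamma$ and arcs $A\Gamma$ (ordered pairs of distinct vertices); its underlying graph joins $x,y$ iff $(x,y)$ or $(y,x)$ is an arc. An $(m,r)$-team semicomplete multipartite digraph ($m,r\geq2$) is a digraph whose underlying graph is the complete multipartite graph with $m$ parts (partite sets) $V_1,\dots,V_m$ each of size $r$. Let $E\Gamma=\{(x,y):(x,y),(y,x)\in A\Gamma\}$, $\vec\Gamma=(V\Gamma,A\Gamma\setminus E\Gamma)$, $A_0,A_1$ the adjacency matrices of $(V\Gamma,E\Gamma)$ and $\vec\Gamma$. A regular such $\Gamma$ is doubly regular if there exist integers $t,\alpha_s,\beta_s,\gamma_s,\eta_s$ ($s=0,1,2$) with $A_iA_j=t\delta_{0,i+j}I+\alpha_{i+j}A_1+\beta_{i+j}A_1^{\top}+\gamma_{i+j}A_0+\eta_{i+j}(J-I-A_1-A_1^{\top}-A_0)$ for all $i,j\in\{0,1\}$ ($J$ the all-ones matrix). For $x\in V_i$ and $j\neq i$, $E_j(x)=\{y\in V_j:(x,y)\in E\Gamma\}$. -}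

module Defs where

open import Data.Nat using (ℕ; zero; suc)
open import Data.Fin using (Fin; zero; suc; toℕ; _≟_)
open import Data.Product using (_×_; _,_; proj₁; proj₂; Σ; ∃)
open import Data.Bool using (Bool; true; false; _∧_; _∨_; not; if_then_else_)
open import Data.Integer as ℤ using (ℤ; +_)
open import Relation.Binary.PropositionalEquality using (_≡_; _≢_)
open import Relation.Nullary.Decidable using (⌊_⌋)

sumℕ : ∀ {n} → (Fin n → ℕ) → ℕ
sumℕ {zero} f = 0
sumℕ {suc n} f = f zero Data.Nat.+ sumℕ (λ k → f (suc k))

sumℤ : ∀ {n} → (Fin n → ℤ) → ℤ
sumℤ {zero} f = + 0
sumℤ {suc n} f = f zero ℤ.+ sumℤ (λ k → f (suc k))

-- Vertex set of an (m,r)-team: vertex (i , a) is the a-th vertex of partite set V_i.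
Vtx : ℕ → ℕ → Set
Vtx m r = Fin m × Fin r

Digraph : ℕ → ℕ → Set
Digraph m r = Vtx m r → Vtx m r → Bool

-- Underlying graph is the complete multipartite graph with parts V_1..V_m:
-- no arcs inside a part (in particular no loops), and every two vertices
-- in distinct parts are joined by at least one arc.
IsTeamSMD : ∀ {m r} → Digraph m r → Set
IsTeamSMD {m} {r} Γ =
  (∀ (x y : Vtx m r) → proj₁ x ≡ proj₁ y → Γ x y ≡ false) ×
  (∀ (x y : Vtx m r) → proj₁ x ≢ proj₁ y → (Γ x y ∨ Γ y x) ≡ true)

b2ℕ : Bool → ℕ
b2ℕ true = 1
b2ℕ false = 0

b2ℤ : Bool → ℤ
b2ℤ b = + (b2ℕ b)

sumV : ∀ {m r} → (Vtx m r → ℕ) → ℕ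
sumV f = sumℕ (λ i → sumℕ (λ a → f (i , a)))

sumVℤ : ∀ {m r} → (Vtx m r → ℤ) → ℤ
sumVℤ f = sumℤ (λ i → sumℤ (λ a → f (i , a)))

outdeg indeg : ∀ {m r} → Digraph m r → Vtx m r → ℕ
outdeg Γ x = sumV (λ y → b2ℕ (Γ x y))
indeg Γ x = sumV (λ y → b2ℕ (Γ y x))

IsRegular : ∀ {m r} → Digraph m r → Set
IsRegular {m} {r} Γ = Σ ℕ λ k → ∀ (x : Vtx m r) → outdeg Γ x ≡ k × indeg Γ x ≡ k

Mat : ℕ → ℕ → Set
Mat m r = Vtx m r → Vtx m r → ℤ

_⊗_ : ∀ {m r} → Mat m r → Mat m r → Mat m r
(A ⊗ B) x y = sumVℤ (λ z → A x z ℤ.* B z y)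

_ᵀ : ∀ {m r} → Mat m r → Mat m r
(A ᵀ) x y = A y x

eqV : ∀ {m r} → Vtx m r → Vtx m r → Bool
eqV (i , a) (j , b) = ⌊ i ≟ j ⌋ ∧ ⌊ a ≟ b ⌋

Iₘ Jₘ : ∀ {m r} → Mat m r
Iₘ x y = b2ℤ (eqV x y)
Jₘ x y = + 1

-- A_0: adjacency matrix of (VΓ, EΓ) (symmetric arcs)
A₀ : ∀ {m r} → Digraph m r → Mat m r
A₀ Γ x y = b2ℤ (Γ x y ∧ Γ y x)

A₁ : ∀ {m r} → Digraph m r → Mat m r
A₁ Γ x y = b2ℤ (Γ x y ∧ not (Γ y x))

Aₛ : ∀ {m r} → Digraph m r → Fin 2 → Mat m r
Aₛ Γ zero = A₀ Γ
Aₛ Γ (suc zero) = A₁ Γ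

add2 : Fin 2 → Fin 2 → Fin 3
add2 zero zero = zero
add2 zero (suc zero) = suc zero
add2 (suc zero) zero = suc zero
add2 (suc zero) (suc zero) = suc (suc zero)

δ0 : Fin 3 → ℤ
δ0 zero = + 1
δ0 (suc _) = + 0

IsDoublyRegular : ∀ {m r} → Digraph m r → Set
IsDoublyRegular {m} {r} Γ =
  IsRegular Γ ×
  Σ ℤ λ t → Σ (Fin 3 → ℤ) λ α → Σ (Fin 3 → ℤ) λ β →
  Σ (Fin 3 → ℤ) λ γ → Σ (Fin 3 → ℤ) λ η →
  ∀ (i j : Fin 2) (x y : Vtx m r) →
    let s = add2 i j in
    (Aₛ Γ i ⊗ Aₛ Γ j) x y ≡
      (t ℤ.* δ0 s ℤ.* Iₘ x y) ℤ.+ (α s ℤ.* A₁ Γ x y) ℤ.+ (β s ℤ.* (A₁ Γ ᵀ) x y)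
      ℤ.+ (γ s ℤ.* A₀ Γ x y)
      ℤ.+ (η s ℤ.* (Jₘ x y ℤ.- Iₘ x y ℤ.- A₁ Γ x y ℤ.- (A₁ Γ ᵀ) x y ℤ.- A₀ Γ x y))

Ecard : ∀ {m r} → Digraph m r → Fin m → Vtx m r → ℕ
Ecard Γ j x = sumℕ (λ b → b2ℕ (Γ x (j , b) ∧ Γ (j , b) x))

{-# OPTIONS --safe #-}
module Submission where

-- Write K for the same-part indicator matrix and U = A₀ + A₁ + A₁ᵀ for the adjacency
-- matrix of the underlying graph, so that K + U = J. Multiplying by A₀ on the left gives
-- A₀K + A₀U = A₀J, where (A₀K)(x, y) = |E_j(x)| for y ∈ V_j and every entry of row x of
-- A₀J is the diagonal entry (A₀²)(x, x) = t. Double regularity makes A₀ commute with A₁,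
-- hence with U, so A₀U is symmetric, and therefore so is A₀K.

open import Defs
open import Data.Nat using (ℕ; zero; suc; _≤_)
open import Data.Fin using (Fin; zero; suc)
open import Data.Fin.Properties using (_≟_)
open import Data.Product using (_×_; _,_; proj₁; proj₂)
open import Data.Bool using (true; false; _∧_; _∨_; not)
open import Data.Bool.Properties using (∧-comm)
open import Data.Integer using (ℤ; +_; _+_; _*_; _-_)
import Data.Integer.Properties as ℤ
open import Data.Integer.Tactic.RingSolver using (solve-∀)
open import Algebra.Properties.Semiring.Sum ℤ.+-*-semiring
  using (sum; sum-cong-≗; sum-replicate-zero; ∑-distrib-+; *-distribʳ-sum)
open import Algebra.Properties.AbelianGroup ℤ.+-0-abelianGroup using (∙-cancelʳ)
open import Relation.Binary.PropositionalEquality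
  using (_≡_; _≢_; refl; sym; trans; cong; cong₂; ≡-≟-identity; module ≡-Reasoning)
open import Relation.Nullary.Decidable using (does; yes; no)

open ≡-Reasoning

sumℤ≡sum : ∀ {n} (f : Fin n → ℤ) → sumℤ f ≡ sum f
sumℤ≡sum {zero}  f = refl
sumℤ≡sum {suc n} f = cong (_+_ (f zero)) (sumℤ≡sum (λ k → f (suc k)))

+-sumℕ : ∀ {n} (f : Fin n → ℕ) → + sumℕ f ≡ sum (λ k → + f k)
+-sumℕ {zero}  f = refl
+-sumℕ {suc n} f = trans (ℤ.pos-+ (f zero) _) (cong (_+_ (+ f zero)) (+-sumℕ (λ k → f (suc k))))

sum-*-δ : ∀ {n} (g : Fin n → ℤ) (j : Fin n) → sum (λ i → g i * b2ℤ (does (i ≟ j))) ≡ g j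
sum-*-δ {suc n} g zero = begin
  g zero * + 1 + sum (λ k → g (suc k) * + 0) ≡⟨ cong₂ _+_ (ℤ.*-identityʳ (g zero)) vanishing ⟩
  g zero + + 0                                ≡⟨ ℤ.+-identityʳ (g zero) ⟩
  g zero                                      ∎
  where
  vanishing : sum (λ k → g (suc k) * + 0) ≡ + 0
  vanishing = trans (sum-cong-≗ (λ k → ℤ.*-zeroʳ (g (suc k)))) (sum-replicate-zero n)
sum-*-δ {suc n} g (suc j) = begin
  g zero * + 0 + sum (λ k → g (suc k) * b2ℤ (does (k ≟ j)))
    ≡⟨ cong₂ _+_ (ℤ.*-zeroʳ (g zero)) (sum-*-δ (λ k → g (suc k)) j) ⟩
  + 0 + g (suc j)
    ≡⟨ ℤ.+-identityˡ (g (suc j)) ⟩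
  g (suc j) ∎

module _ {m r : ℕ} where

  sumVℤ≡sum-sum : (f : Vtx m r → ℤ) → sumVℤ f ≡ sum (λ i → sum (λ a → f (i , a)))
  sumVℤ≡sum-sum f =
    trans (sumℤ≡sum (λ i → sumℤ (λ a → f (i , a)))) (sum-cong-≗ (λ i → sumℤ≡sum (λ a → f (i , a))))

  sumVℤ-cong : {f g : Vtx m r → ℤ} → (∀ z → f z ≡ g z) → sumVℤ f ≡ sumVℤ g
  sumVℤ-cong {f} {g} f≗g = begin
    sumVℤ f                             ≡⟨ sumVℤ≡sum-sum f ⟩
    sum (λ i → sum (λ a → f (i , a)))   ≡⟨ sum-cong-≗ (λ i → sum-cong-≗ (λ a → f≗g (i , a))) ⟩
    sum (λ i → sum (λ a → g (i , a)))   ≡⟨ sumVℤ≡sum-sum g ⟨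
    sumVℤ g                             ∎

  sumVℤ-distrib-+ : (f g : Vtx m r → ℤ) → sumVℤ (λ z → f z + g z) ≡ sumVℤ f + sumVℤ g
  sumVℤ-distrib-+ f g = begin
    sumVℤ (λ z → f z + g z)
      ≡⟨ sumVℤ≡sum-sum (λ z → f z + g z) ⟩
    sum (λ i → sum (λ a → f (i , a) + g (i , a)))
      ≡⟨ sum-cong-≗ (λ i → ∑-distrib-+ (f-row i) (g-row i)) ⟩
    sum (λ i → sum (f-row i) + sum (g-row i))
      ≡⟨ ∑-distrib-+ (λ i → sum (f-row i)) (λ i → sum (g-row i)) ⟩
    sum (λ i → sum (f-row i)) + sum (λ i → sum (g-row i))
      ≡⟨ cong₂ _+_ (sumVℤ≡sum-sum f) (sumVℤ≡sum-sum g) ⟨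
    sumVℤ f + sumVℤ g ∎
    where
    f-row g-row : Fin m → Fin r → ℤ
    f-row i a = f (i , a)
    g-row i a = g (i , a)

  infixl 6 _⊞_

  _⊞_ : Mat m r → Mat m r → Mat m r
  (A ⊞ B) x y = A x y + B x y

  IsSymmetric : Mat m r → Set
  IsSymmetric A = ∀ x y → A x y ≡ A y x

  ⊗-congˡ : (A : Mat m r) {B C : Mat m r} → (∀ z y → B z y ≡ C z y) →
            ∀ x y → (A ⊗ B) x y ≡ (A ⊗ C) x y
  ⊗-congˡ A B≗C x y = sumVℤ-cong (λ z → cong (A x z *_) (B≗C z y))

  ⊗-distribˡ-⊞ : (A B C : Mat m r) → ∀ x y → (A ⊗ (B ⊞ C)) x y ≡ (A ⊗ B) x y + (A ⊗ C) x y
  ⊗-distribˡ-⊞ A B C x y =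
    trans (sumVℤ-cong (λ z → ℤ.*-distribˡ-+ (A x z) (B z y) (C z y))) (sumVℤ-distrib-+ _ _)

  ⊗-distribʳ-⊞ : (A B C : Mat m r) → ∀ x y → ((B ⊞ C) ⊗ A) x y ≡ (B ⊗ A) x y + (C ⊗ A) x y
  ⊗-distribʳ-⊞ A B C x y =
    trans (sumVℤ-cong (λ z → ℤ.*-distribʳ-+ (A z y) (B x z) (C x z))) (sumVℤ-distrib-+ _ _)

  ⊗-ᵀ : (A B : Mat m r) → ∀ x y → (A ⊗ B) y x ≡ ((B ᵀ) ⊗ (A ᵀ)) x y
  ⊗-ᵀ A B x y = sumVℤ-cong (λ z → ℤ.*-comm (A y z) (B z x))

  Commute : Mat m r → Mat m r → Set
  Commute A B = ∀ x y → (A ⊗ B) x y ≡ (B ⊗ A) x y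

  commute-refl : (A : Mat m r) → Commute A A
  commute-refl A x y = refl

  commute-⊞ : {A B C : Mat m r} → Commute A B → Commute A C → Commute A (B ⊞ C)
  commute-⊞ {A} {B} {C} AB≡BA AC≡CA x y = begin
    (A ⊗ (B ⊞ C)) x y             ≡⟨ ⊗-distribˡ-⊞ A B C x y ⟩
    (A ⊗ B) x y + (A ⊗ C) x y     ≡⟨ cong₂ _+_ (AB≡BA x y) (AC≡CA x y) ⟩
    (B ⊗ A) x y + (C ⊗ A) x y     ≡⟨ ⊗-distribʳ-⊞ A B C x y ⟨
    ((B ⊞ C) ⊗ A) x y             ∎

  commute-ᵀ : {A B : Mat m r} → IsSymmetric A → Commute A B → Commute A (B ᵀ)
  commute-ᵀ {A} {B} A-sym AB≡BA x y = begin
    (A ⊗ (B ᵀ)) x y               ≡⟨ sumVℤ-cong (λ z → cong (_* B y z) (A-sym x z)) ⟩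
    ((A ᵀ) ⊗ (B ᵀ)) x y           ≡⟨ ⊗-ᵀ B A x y ⟨
    (B ⊗ A) y x                   ≡⟨ AB≡BA y x ⟨
    (A ⊗ B) y x                   ≡⟨ ⊗-ᵀ A B x y ⟩
    ((B ᵀ) ⊗ (A ᵀ)) x y           ≡⟨ sumVℤ-cong (λ z → cong (B z x *_) (A-sym y z)) ⟩
    ((B ᵀ) ⊗ A) x y               ∎

  ⊗-symmetric : {A B : Mat m r} → IsSymmetric A → IsSymmetric B → Commute A B → IsSymmetric (A ⊗ B)
  ⊗-symmetric {A} {B} A-sym B-sym AB≡BA x y = begin
    (A ⊗ B) x y                   ≡⟨ AB≡BA x y ⟩
    (B ⊗ A) x y                   ≡⟨ sumVℤ-cong (λ z → cong₂ _*_ (B-sym x z) (A-sym z y)) ⟩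
    ((B ᵀ) ⊗ (A ᵀ)) x y           ≡⟨ ⊗-ᵀ A B x y ⟨
    (A ⊗ B) y x                   ∎

  SamePart : Mat m r
  SamePart x y = b2ℤ (does (proj₁ x ≟ proj₁ y))

  ⊗-SamePart : (A : Mat m r) → ∀ x y → (A ⊗ SamePart) x y ≡ sum (λ b → A x (proj₁ y , b))
  ⊗-SamePart A x y = begin
    sumVℤ (λ z → A x z * SamePart z y)
      ≡⟨ sumVℤ≡sum-sum (λ z → A x z * SamePart z y) ⟩
    sum (λ i → sum (λ a → A x (i , a) * δ i))
      ≡⟨ sum-cong-≗ (λ i → *-distribʳ-sum (δ i) (λ a → A x (i , a))) ⟨
    sum (λ i → sum (λ a → A x (i , a)) * δ i)
      ≡⟨ sum-*-δ (λ i → sum (λ a → A x (i , a))) (proj₁ y) ⟩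
    sum (λ b → A x (proj₁ y , b)) ∎
    where
    δ : Fin m → ℤ
    δ i = b2ℤ (does (i ≟ proj₁ y))

  Iₘ-diagonal : ∀ x → Iₘ {m} {r} x x ≡ + 1
  Iₘ-diagonal (i , a) rewrite ≡-≟-identity _≟_ {i} refl | ≡-≟-identity _≟_ {a} refl = refl

module _ {m r : ℕ} (Γ : Digraph m r) where

  Underlying : Mat m r
  Underlying = A₀ Γ ⊞ A₁ Γ ⊞ A₁ Γ ᵀ

  A₀-symmetric : IsSymmetric (A₀ Γ)
  A₀-symmetric x y = cong b2ℤ (∧-comm (Γ x y) (Γ y x))

  Underlying-symmetric : IsSymmetric Underlying
  Underlying-symmetric x y = begin
    A₀ Γ x y + A₁ Γ x y + A₁ Γ y x   ≡⟨ cong (λ e → e + A₁ Γ x y + A₁ Γ y x) (A₀-symmetric x y) ⟩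
    A₀ Γ y x + A₁ Γ x y + A₁ Γ y x   ≡⟨ ℤ.+-assoc (A₀ Γ y x) (A₁ Γ x y) (A₁ Γ y x) ⟩
    A₀ Γ y x + (A₁ Γ x y + A₁ Γ y x) ≡⟨ cong (_+_ (A₀ Γ y x)) (ℤ.+-comm (A₁ Γ x y) (A₁ Γ y x)) ⟩
    A₀ Γ y x + (A₁ Γ y x + A₁ Γ x y) ≡⟨ ℤ.+-assoc (A₀ Γ y x) (A₁ Γ y x) (A₁ Γ x y) ⟨
    A₀ Γ y x + A₁ Γ y x + A₁ Γ x y   ∎

  A₀⊗SamePart≡Ecard : ∀ x y → (A₀ Γ ⊗ SamePart) x y ≡ + Ecard Γ (proj₁ y) x
  A₀⊗SamePart≡Ecard x y =
    trans (⊗-SamePart (A₀ Γ) x y) (sym (+-sumℕ (λ b → b2ℕ (Γ x (proj₁ y , b) ∧ Γ (proj₁ y , b) x))))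

  -- A₀ is a symmetric 0/1 matrix, so each row sum of A₀ is the square of that row's norm.
  A₀⊗J≡A₀²-diagonal : ∀ x y → (A₀ Γ ⊗ Jₘ) x y ≡ (A₀ Γ ⊗ A₀ Γ) x x
  A₀⊗J≡A₀²-diagonal x y =
    sumVℤ-cong (λ z → trans (idempotent (Γ x z ∧ Γ z x)) (cong (A₀ Γ x z *_) (A₀-symmetric x z)))
    where
    idempotent : ∀ b → b2ℤ b * + 1 ≡ b2ℤ b * b2ℤ b
    idempotent true  = refl
    idempotent false = refl

module _ {m r : ℕ} {Γ : Digraph m r} (team : IsTeamSMD Γ) where

  A₀-loopless : ∀ x → A₀ Γ x x ≡ + 0
  A₀-loopless x rewrite proj₁ team x x refl = refl

  A₁-loopless : ∀ x → A₁ Γ x x ≡ + 0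
  A₁-loopless x rewrite proj₁ team x x refl = refl

  SamePart⊞Underlying≡J : ∀ x y → (SamePart ⊞ Underlying Γ) x y ≡ Jₘ x y
  SamePart⊞Underlying≡J x y with proj₁ x ≟ proj₁ y
  ... | yes same rewrite proj₁ team x y same | proj₁ team y x (sym same) = refl
  ... | no apart = exactly-one (Γ x y) (Γ y x) (proj₂ team x y apart)
    where
    exactly-one : ∀ b c → (b ∨ c) ≡ true →
                  + 0 + (b2ℤ (b ∧ c) + b2ℤ (b ∧ not c) + b2ℤ (c ∧ not b)) ≡ + 1
    exactly-one true  true  _ = refl
    exactly-one true  false _ = refl
    exactly-one false true  _ = refl

  Ecard+A₀⊗Underlying≡A₀²-diagonal :
    ∀ x y → + Ecard Γ (proj₁ y) x + (A₀ Γ ⊗ Underlying Γ) x y ≡ (A₀ Γ ⊗ A₀ Γ) x x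
  Ecard+A₀⊗Underlying≡A₀²-diagonal x y = begin
    + Ecard Γ (proj₁ y) x + (A₀ Γ ⊗ Underlying Γ) x y
      ≡⟨ cong (_+ (A₀ Γ ⊗ Underlying Γ) x y) (A₀⊗SamePart≡Ecard Γ x y) ⟨
    (A₀ Γ ⊗ SamePart) x y + (A₀ Γ ⊗ Underlying Γ) x y
      ≡⟨ ⊗-distribˡ-⊞ (A₀ Γ) SamePart (Underlying Γ) x y ⟨
    (A₀ Γ ⊗ (SamePart ⊞ Underlying Γ)) x y
      ≡⟨ ⊗-congˡ (A₀ Γ) SamePart⊞Underlying≡J x y ⟩
    (A₀ Γ ⊗ Jₘ) x y
      ≡⟨ A₀⊗J≡A₀²-diagonal Γ x y ⟩
    (A₀ Γ ⊗ A₀ Γ) x x ∎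

module _ {m r : ℕ} {Γ : Digraph m r} where

  A₀-commutes-with-A₁ : IsDoublyRegular Γ → Commute (A₀ Γ) (A₁ Γ)
  A₀-commutes-with-A₁ (_ , _ , _ , _ , _ , _ , products) x y =
    trans (products zero (suc zero) x y) (sym (products (suc zero) zero x y))

  A₀-commutes-with-Underlying : IsDoublyRegular Γ → Commute (A₀ Γ) (Underlying Γ)
  A₀-commutes-with-Underlying doublyRegular =
    commute-⊞ {B = A₀ Γ ⊞ A₁ Γ} {C = A₁ Γ ᵀ}
      (commute-⊞ {B = A₀ Γ} {C = A₁ Γ} (commute-refl (A₀ Γ)) A₀A₁≡A₁A₀)
      (commute-ᵀ (A₀-symmetric Γ) A₀A₁≡A₁A₀)
    where
    A₀A₁≡A₁A₀ : Commute (A₀ Γ) (A₁ Γ)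
    A₀A₁≡A₁A₀ = A₀-commutes-with-A₁ doublyRegular

  A₀²-diagonal-constant : IsTeamSMD Γ → IsDoublyRegular Γ →
                          ∀ x y → (A₀ Γ ⊗ A₀ Γ) x x ≡ (A₀ Γ ⊗ A₀ Γ) y y
  A₀²-diagonal-constant team (_ , t , α , β , γ , η , products) x y =
    trans (diagonal≡t x) (sym (diagonal≡t y))
    where
    entry : ℤ → ℤ → ℤ → ℤ
    entry I a₁ a₀ =
      t * + 1 * I + α zero * a₁ + β zero * a₁ + γ zero * a₀ + η zero * (+ 1 - I - a₁ - a₁ - a₀)

    only-t-survives : ∀ t a b c e →
      t * + 1 * + 1 + a * + 0 + b * + 0 + c * + 0 + e * (+ 1 - + 1 - + 0 - + 0 - + 0) ≡ t
    only-t-survives = solve-∀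

    entry-on-diagonal : ∀ {I a₁ a₀} → I ≡ + 1 → a₁ ≡ + 0 → a₀ ≡ + 0 → entry I a₁ a₀ ≡ t
    entry-on-diagonal refl refl refl = only-t-survives t (α zero) (β zero) (γ zero) (η zero)

    diagonal≡t : ∀ x → (A₀ Γ ⊗ A₀ Γ) x x ≡ t
    diagonal≡t x = trans (products zero zero x x)
                 (entry-on-diagonal (Iₘ-diagonal x) (A₁-loopless team x) (A₀-loopless team x))

  Ecard-symmetric : IsTeamSMD Γ → IsDoublyRegular Γ →
                    ∀ x y → Ecard Γ (proj₁ y) x ≡ Ecard Γ (proj₁ x) y
  Ecard-symmetric team doublyRegular x y = ℤ.+-injective (∙-cancelʳ (A₀U x y) _ _ (begin
    + Ecard Γ (proj₁ y) x + A₀U x y  ≡⟨ Ecard+A₀⊗Underlying≡A₀²-diagonal team x y ⟩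
    (A₀ Γ ⊗ A₀ Γ) x x                ≡⟨ A₀²-diagonal-constant team doublyRegular x y ⟩
    (A₀ Γ ⊗ A₀ Γ) y y                ≡⟨ Ecard+A₀⊗Underlying≡A₀²-diagonal team y x ⟨
    + Ecard Γ (proj₁ x) y + A₀U y x  ≡⟨ cong (_+_ (+ Ecard Γ (proj₁ x) y)) (A₀U-symmetric y x) ⟩
    + Ecard Γ (proj₁ x) y + A₀U x y  ∎))
    where
    A₀U : Mat m r
    A₀U = A₀ Γ ⊗ Underlying Γ

    A₀U-symmetric : IsSymmetric A₀U
    A₀U-symmetric = ⊗-symmetric (A₀-symmetric Γ) (Underlying-symmetric Γ)
                                (A₀-commutes-with-Underlying doublyRegular)

lemma3p4 : (m r : ℕ) → 2 ≤ m → 2 ≤ r → (Γ : Digraph m r) →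
    IsTeamSMD Γ → IsDoublyRegular Γ →
    ∀ (i j : Fin m) → i ≢ j →
      (∀ (a b : Fin r) → Ecard Γ j (i , a) ≡ Ecard Γ i (j , b)) ×
      (∀ (a a′ : Fin r) → Ecard Γ j (i , a) ≡ Ecard Γ j (i , a′))
lemma3p4 m r _ _ Γ team doublyRegular i j _ = across , within
  where
  across : ∀ a b → Ecard Γ j (i , a) ≡ Ecard Γ i (j , b)
  across a b = Ecard-symmetric team doublyRegular (i , a) (j , b)

  within : ∀ a a′ → Ecard Γ j (i , a) ≡ Ecard Γ j (i , a′)
  within a a′ = trans (across a a) (sym (across a′ a))
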